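{- Let $H$ be a bounded Hilbert algebra and $\gamma$ a $\gamma$-operator on $H$. Then $(X(H)^+,\cap,\Rightarrow,\emptyset,X(H),\gamma^{\pi})$ is a bounded implicative semilattice in which $\gamma^{\pi}$ is a $\gamma$-operator (of its bounded Hilbert algebra reduct). Moreover, $\gamma^{\pi}(U)=U\cup(X(H))_M$ for every $U\in X(H)^+$.
   Context: A Hilbert algebra is $(H,\to,1)$ with $a\to(b\to a)=1$, $(a\to(b\to c))\to((a\to b)\to(a\to c))=1$, and $a\to b=b\to a=1\Rightarrow a=b$; natural order $a\le b$ iff $a\to b=1$; bounded if it has least element $0$ in the signature; $\neg a:=a\to0$. A $\gamma$-operator on a bounded Hilbert algebra is a map $\tau$ such that for all $a,b$: $\tau(a\to b)\le\tau(a)\to\tau(b)$, $a\le\tau(a)$, $\tau(a)\le((b\to a)\to b)\to b$, $\neg\tau(a)\le\tau(a)$, $\tau(a)\le(a\to b)\to((\neg b\to b)\to b)$. A bounded implicative semilattice is a meet-semilattice with top and bottom and an operation $\to$ with $a\wedge b\le c$ iff $a\le b\to c$. An implicative filter of $H$ is $F\ni1$ with $a,a\to b\in F\Rightarrow b\in F$; irreducible if proper and not the intersection of two implicative filters both different from it. $X(H)$: irreducible implicative filters ordered by inclusion; $(X(H))_M$: its maximal elements; $X(H)^+$: its upsets; $U\Rightarrow V=\{P:\forall Q\in X(H)(P\subseteq Q,Q\in U\Rightarrow Q\in V)\}$. $\gamma^{\pi}(U)=\{P\in X(H):\forall Q\in X(H)(\gamma^{ -1}[P]\subseteq Q\Rightarrow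 Q\in U)\}$. -}

module Defs where

open import Level using (Level; _⊔_; Lift) renaming (suc to lsuc)
open import Data.Empty using (⊥)
open import Data.Unit.Polymorphic using (⊤)
open import Data.Product using (Σ; ∃; _×_; _,_; proj₁; proj₂)
open import Data.Sum using (_⊎_)
open import Relation.Nullary using (¬_)
open import Relation.Binary.Core using (Rel)
open import Relation.Binary.PropositionalEquality using (_≡_)
open import Relation.Binary.Structures using (IsEquivalence)
open import Relation.Binary.Definitions using (Minimum)
open import Algebra.Core using (Op₂)
open import Relation.Binary.Lattice.Structures using (IsBoundedMeetSemilattice)

module _ {a ℓ : Level} {A : Set a} (_≈_ : Rel A ℓ) (_⇒_ : Op₂ A) (one zero : A) where

  HilbertOrder : Rel A ℓ
  HilbertOrder x y = (x ⇒ y) ≈ one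

  record IsBoundedHilbertAlgebra : Set (a ⊔ ℓ) where
    field
      isEquivalence : IsEquivalence _≈_
      ⇒-cong        : ∀ {x x' y y'} → x ≈ x' → y ≈ y' → (x ⇒ y) ≈ (x' ⇒ y')
      axK           : ∀ x y → (x ⇒ (y ⇒ x)) ≈ one
      axS           : ∀ x y z → ((x ⇒ (y ⇒ z)) ⇒ ((x ⇒ y) ⇒ (x ⇒ z))) ≈ one
      antisym       : ∀ x y → (x ⇒ y) ≈ one → (y ⇒ x) ≈ one → x ≈ y
      least         : ∀ x → (zero ⇒ x) ≈ one

  neg : A → A
  neg x = x ⇒ zero

  record IsGammaOperator (τ : A → A) : Set (a ⊔ ℓ) where
    field
      τ-cong : ∀ {x y} → x ≈ y → τ x ≈ τ y
      γ1 : ∀ x y → HilbertOrder (τ (x ⇒ y)) (τ x ⇒ τ y)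
      γ2 : ∀ x → HilbertOrder x (τ x)
      γ3 : ∀ x y → HilbertOrder (τ x) (((y ⇒ x) ⇒ y) ⇒ y)
      γ4 : ∀ x → HilbertOrder (neg (τ x)) (τ x)
      γ5 : ∀ x y → HilbertOrder (τ x) ((x ⇒ y) ⇒ (((neg y) ⇒ y) ⇒ y))

record BoundedHilbertAlgebra (c : Level) : Set (lsuc c) where
  infixr 5 _⇒_
  field
    Carrier : Set c
    _⇒_     : Op₂ Carrier
    one     : Carrier
    zero    : Carrier
    isBoundedHilbertAlgebra : IsBoundedHilbertAlgebra _≡_ _⇒_ one zero

record IsBoundedImplicativeSemilattice {a ℓ₁ ℓ₂ : Level} {A : Set a}
  (_≈_ : Rel A ℓ₁) (_≤_ : Rel A ℓ₂) (_∧_ _⇒_ : Op₂ A) (top bot : A)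
  : Set (a ⊔ ℓ₁ ⊔ ℓ₂) where
  field
    isBoundedMeetSemilattice : IsBoundedMeetSemilattice _≈_ _≤_ _∧_ top
    minimum    : Minimum _≤_ bot
    residuated : ∀ x y z → ((x ∧ y) ≤ z → x ≤ (y ⇒ z)) × (x ≤ (y ⇒ z) → (x ∧ y) ≤ z)

Zorn : (ℓ : Level) → Set (lsuc ℓ)
Zorn ℓ = (A : Set ℓ) (_≤_ : Rel A ℓ) →
  (∀ x → x ≤ x) → (∀ {x y z} → x ≤ y → y ≤ z → x ≤ z) →
  (∀ (C : A → Set ℓ) → (∀ x y → C x → C y → (x ≤ y) ⊎ (y ≤ x)) →
     Σ A λ u → ∀ x → C x → x ≤ u) →
  ∀ x → Σ A λ m → (x ≤ m) × (∀ y → m ≤ y → y ≤ m)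

module Spectral {c : Level} (H : BoundedHilbertAlgebra c) where
  open BoundedHilbertAlgebra H

  Subset : Set (lsuc c)
  Subset = Carrier → Set c

  _⊆_ : Subset → Subset → Set c
  F ⊆ G = ∀ x → F x → G x

  _≐_ : Subset → Subset → Set c
  F ≐ G = (F ⊆ G) × (G ⊆ F)

  IsImplicativeFilter : Subset → Set c
  IsImplicativeFilter F = F one × (∀ x y → F x → F (x ⇒ y) → F y)

  IsIrreducible : Subset → Set (lsuc c)
  IsIrreducible F =
    (¬ (∀ x → F x)) ×
    ¬ (Σ Subset λ G₁ → Σ Subset λ G₂ →
         IsImplicativeFilter G₁ × IsImplicativeFilter G₂ ×
         ¬ (G₁ ≐ F) × ¬ (G₂ ≐ F) × (F ≐ (λ x → G₁ x × G₂ x)))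

  X : Set (lsuc c)
  X = Σ Subset λ F → IsImplicativeFilter F × IsIrreducible F

  _⊑_ : X → X → Set c
  P ⊑ Q = proj₁ P ⊆ proj₁ Q

  IsMaximal : X → Set (lsuc c)
  IsMaximal P = ∀ Q → P ⊑ Q → Q ⊑ P

  XPred : Set (lsuc (lsuc c))
  XPred = X → Set (lsuc c)

  IsUpset : XPred → Set (lsuc c)
  IsUpset U = ∀ P Q → P ⊑ Q → U P → U Q

  Upset : Set (lsuc (lsuc c))
  Upset = Σ XPred IsUpset

  _⊆ᵁ_ : Rel Upset (lsuc c)
  U ⊆ᵁ V = ∀ P → proj₁ U P → proj₁ V P

  _≈ᵁ_ : Rel Upset (lsuc c)
  U ≈ᵁ V = (U ⊆ᵁ V) × (V ⊆ᵁ U)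

  ⊑-trans : ∀ {P Q R} → P ⊑ Q → Q ⊑ R → P ⊑ R
  ⊑-trans p q x h = q x (p x h)

  _∩ᵁ_ : Op₂ Upset
  (U , u) ∩ᵁ (V , v) = (λ P → U P × V P) , λ P Q le h → u P Q le (proj₁ h) , v P Q le (proj₂ h)

  _⇒ᵁ_ : Op₂ Upset
  (U , u) ⇒ᵁ (V , v) = (λ P → ∀ Q → P ⊑ Q → U Q → V Q) ,
                       λ P P' le h Q le' uQ → h Q (⊑-trans {P} {P'} {Q} le le') uQ

  ∅ᵁ : Upset
  ∅ᵁ = (λ _ → Lift (lsuc c) ⊥) , λ _ _ _ h → h

  Xᵁ : Upset
  Xᵁ = (λ _ → ⊤) , λ _ _ _ h → h

  preimage : (Carrier → Carrier) → X → Subset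
  preimage γ P x = proj₁ P (γ x)

  γπ : (Carrier → Carrier) → Upset → Upset
  γπ γ (U , u) = (λ P → ∀ Q → preimage γ P ⊆ proj₁ Q → U Q) ,
                 λ P P' le h Q sub → h Q (λ x g → sub x (le (γ x) g))

module Submission where

-- The heart of the proof is the description of γ^π.  Two facts about points
-- P ∈ X(H) give it:
--   * a maximal P contains γ0 (it contains γ0 or ¬γ0, and ¬γ0 ≤ γ0), so
--     γ⁻¹[P] lies in no Q ∈ X(H) and P ∈ γ^π(U) vacuously;
--   * a non-maximal P has an element d with d, ¬d ∉ P; using that the
--     complement of an irreducible filter is ⇒-directed, every a ∉ P has a
--     z ∉ P with a ⇒ z, ¬z ⇒ z ∈ P, so by axiom γ5 also γa ∉ P, i.e.
--     γ⁻¹[P] ⊆ P and P ∈ γ^π(U) forces P ∈ U.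

open import Defs
open import Level using (Level; Lift; lift; lower) renaming (suc to lsuc)
open import Data.Product using (Σ; _×_; _,_; proj₁; proj₂)
open import Data.Sum using (_⊎_; inj₁; inj₂)
open import Data.Empty using (⊥-elim)
open import Data.Unit.Polymorphic using (tt)
open import Relation.Nullary using (¬_; Dec; yes; no)
open import Relation.Nullary.Decidable using (map′; True; toWitness; fromWitness; decidable-stable)
open import Relation.Binary.PropositionalEquality using (_≡_; subst; sym)
open import Axiom.ExcludedMiddle using (ExcludedMiddle)

module Classical {c : Level} (em : ExcludedMiddle (lsuc c)) where

  dec : (A : Set c) → Dec A
  dec A = map′ lower lift em

  by-contradiction : {A : Set c} → ¬ ¬ A → A
  by-contradiction {A} = decidable-stable (dec A)

  by-contradiction⁺ : {A : Set (lsuc c)} → ¬ ¬ A → A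
  by-contradiction⁺ = decidable-stable em

  -- A large proposition has an equivalent small one (its truth value); this
  -- lets a union of a chain of filters be a subset of the small carrier.
  Resize : Set (lsuc c) → Set c
  Resize A = Lift c (True (em {A}))

  resize : (A : Set (lsuc c)) → A → Resize A
  resize A a = lift (fromWitness {a? = em {A}} a)

  unresize : (A : Set (lsuc c)) → Resize A → A
  unresize A r = toWitness {a? = em {A}} (lower r)

module FilterCalculus {c : Level} (H : BoundedHilbertAlgebra c) where
  open BoundedHilbertAlgebra H
  open IsBoundedHilbertAlgebra isBoundedHilbertAlgebra
  open Spectral H using (Subset; _⊆_; IsImplicativeFilter)

  infix 8 ∼_
  ∼_ : Carrier → Carrier
  ∼_ = neg _≡_ _⇒_ one zero

  module _ {F : Subset} (isFilter : IsImplicativeFilter F) where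

    mp : ∀ {x y} → F x → F (x ⇒ y) → F y
    mp {x} {y} = proj₂ isFilter x y

    theorem : ∀ {t} → t ≡ one → F t
    theorem t≡1 = subst F (sym t≡1) (proj₁ isFilter)

    upward : ∀ {x y} → (x ⇒ y) ≡ one → F x → F y
    upward x≤y x∈F = mp x∈F (theorem x≤y)

    weaken : ∀ {x} y → F x → F (y ⇒ x)
    weaken {x} y = upward (axK x y)

    ⇒-refl : ∀ x → F (x ⇒ x)
    ⇒-refl x = mp (theorem (axK x x)) (mp (theorem (axK x (x ⇒ x))) (theorem (axS x (x ⇒ x) x)))

    explode : F zero → ∀ y → F y
    explode 0∈F y = upward (least y) 0∈F

  -- adjoin F x = {w | x ⇒ w ∈ F}, the filter generated by F and x: it plays
  -- the role of "assuming x" in the deduction arguments below.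
  adjoin : Subset → Carrier → Subset
  adjoin F x w = F (x ⇒ w)

  module _ {F : Subset} (isFilter : IsImplicativeFilter F) (x : Carrier) where

    adjoin-isFilter : IsImplicativeFilter (adjoin F x)
    adjoin-isFilter = weaken isFilter x (proj₁ isFilter) ,
      λ y z x⇒y∈F x⇒y⇒z∈F → mp isFilter x⇒y∈F (mp isFilter x⇒y⇒z∈F (theorem isFilter (axS x y z)))

    adjoin-⊇ : F ⊆ adjoin F x
    adjoin-⊇ _ = weaken isFilter x

    adjoin-∋ : adjoin F x x
    adjoin-∋ = ⇒-refl isFilter x

  module _ {F : Subset} (isFilter : IsImplicativeFilter F) where

    ⇒-trans : ∀ {x y z} → F (x ⇒ y) → F (y ⇒ z) → F (x ⇒ z)
    ⇒-trans {x} {y} {z} x⇒y∈F y⇒z∈F =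
      mp (adjoin-isFilter isFilter x) x⇒y∈F (adjoin-⊇ isFilter x (y ⇒ z) y⇒z∈F)

    -- Proof by cases: if d and ¬d both imply y, then ¬y implies y.
    -- Assuming ¬y, the further assumption d yields y and hence 0, so ¬d holds.
    by-cases : ∀ {d y} → F (d ⇒ y) → F (∼ d ⇒ y) → F (∼ y ⇒ y)
    by-cases {d} {y} d⇒y∈F ∼d⇒y∈F = mp isG ∼d∈G (adjoin-⊇ isFilter (∼ y) _ ∼d⇒y∈F)
      where
      isG = adjoin-isFilter isFilter (∼ y)
      isGd = adjoin-isFilter isG d
      y∈Gd : adjoin (adjoin F (∼ y)) d y
      y∈Gd = mp isGd (adjoin-∋ isG d) (adjoin-⊇ isG d _ (adjoin-⊇ isFilter (∼ y) _ d⇒y∈F))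
      ∼d∈G : adjoin F (∼ y) (∼ d)
      ∼d∈G = mp isGd y∈Gd (adjoin-⊇ isG d _ (adjoin-∋ isFilter (∼ y)))

module IrreducibleFilters {c : Level} (em : ExcludedMiddle (lsuc c)) (H : BoundedHilbertAlgebra c) where
  open BoundedHilbertAlgebra H
  open Spectral H
  open Classical em
  open FilterCalculus H

  filterOf : (P : X) → IsImplicativeFilter (proj₁ P)
  filterOf P = proj₁ (proj₂ P)

  omits-zero : (P : X) → ¬ proj₁ P zero
  omits-zero (F , isF , proper , _) 0∈F = proper (explode isF 0∈F)

  -- The complement of an irreducible filter is directed for ⇒: otherwise F
  -- would be the intersection of the strictly larger filters F+x and F+y.
  directed : (P : X) → ∀ {x y} → ¬ proj₁ P x → ¬ proj₁ P y →
    Σ Carrier λ z → ¬ proj₁ P z × proj₁ P (x ⇒ z) × proj₁ P (y ⇒ z)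
  directed (F , isF , _ , irreducible) {x} {y} x∉F y∉F = by-contradiction λ none →
    irreducible (adjoin F x , adjoin F y , adjoin-isFilter isF x , adjoin-isFilter isF y ,
      (λ Fx≐F → x∉F (proj₁ Fx≐F x (adjoin-∋ isF x))) ,
      (λ Fy≐F → y∉F (proj₁ Fy≐F y (adjoin-∋ isF y))) ,
      (λ w w∈F → adjoin-⊇ isF x w w∈F , adjoin-⊇ isF y w w∈F) ,
      λ w (x⇒w∈F , y⇒w∈F) → by-contradiction λ w∉F → none (w , w∉F , x⇒w∈F , y⇒w∈F))

  witness-⊈ : {F G : Subset} → ¬ (F ⊆ G) → Σ Carrier λ w → F w × ¬ G w
  witness-⊈ F⊈G = by-contradiction λ none →
    F⊈G λ w w∈F → by-contradiction λ w∉G → none (w , w∈F , w∉G)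

  strictly-above : (P : X) → ¬ IsMaximal P → Σ X λ Q → P ⊑ Q × ¬ (Q ⊑ P)
  strictly-above P notMax = by-contradiction⁺ λ none →
    notMax λ Q P⊑Q → by-contradiction λ Q⋢P → none (Q , P⊑Q , Q⋢P)

  -- A non-maximal point P decides neither d nor ¬d for some d: take d ∈ Q ∖ P
  -- for a point Q ⊋ P; then ¬d ∈ P ⊆ Q would put 0 in Q.
  undecided : (P : X) → ¬ IsMaximal P → Σ Carrier λ d → ¬ proj₁ P d × ¬ proj₁ P (∼ d)
  undecided P notMax with strictly-above P notMax
  ... | Q , P⊑Q , Q⋢P with witness-⊈ {proj₁ Q} {proj₁ P} Q⋢P
  ...   | d , d∈Q , d∉P = d , d∉P , λ ∼d∈P → omits-zero Q (mp (filterOf Q) d∈Q (P⊑Q (∼ d) ∼d∈P))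

  -- Separation at a non-maximal point: every a ∉ P has z ∉ P with a ⇒ z ∈ P
  -- and ¬z ⇒ z ∈ P.  Directedness gives w ∉ P above d and ¬d, then z ∉ P above
  -- a and w; proof by cases turns d ⇒ z and ¬d ⇒ z into ¬z ⇒ z.
  separation : (P : X) → ¬ IsMaximal P → ∀ {a} → ¬ proj₁ P a →
    Σ Carrier λ z → ¬ proj₁ P z × proj₁ P (a ⇒ z) × proj₁ P (∼ z ⇒ z)
  separation P notMax a∉P with undecided P notMax
  ... | d , d∉P , ∼d∉P with directed P d∉P ∼d∉P
  ...   | w , w∉P , d⇒w∈P , ∼d⇒w∈P with directed P a∉P w∉P
  ...     | z , z∉P , a⇒z∈P , w⇒z∈P =
    z , z∉P , a⇒z∈P , by-cases isP (⇒-trans isP d⇒w∈P w⇒z∈P) (⇒-trans isP ∼d⇒w∈P w⇒z∈P)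
    where isP = filterOf P

module MaximalFilters {c : Level} (em : ExcludedMiddle (lsuc c)) (zorn : Zorn (lsuc c))
  (H : BoundedHilbertAlgebra c) where
  open BoundedHilbertAlgebra H
  open Spectral H
  open Classical em
  open FilterCalculus H
  open IrreducibleFilters em H

  IsProperFilter : Subset → Set c
  IsProperFilter F = IsImplicativeFilter F × ¬ F zero

  IsMaximalProper : Subset → Set (lsuc c)
  IsMaximalProper M = ∀ G → IsProperFilter G → M ⊆ G → G ⊆ M

  module _ (F : Subset) (properF : IsProperFilter F) where

    ProperAbove : Set (lsuc c)
    ProperAbove = Σ Subset λ G → IsProperFilter G × F ⊆ G

    _≤_ : ProperAbove → ProperAbove → Set (lsuc c)
    A ≤ B = Lift (lsuc c) (proj₁ A ⊆ proj₁ B)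

    -- F together with the union of a chain of proper filters above F is a
    -- proper filter: any two of its elements lie in one member of the chain.
    chain-bound : (C : ProperAbove → Set (lsuc c)) → (∀ A B → C A → C B → A ≤ B ⊎ B ≤ A) →
      Σ ProperAbove λ U → ∀ A → C A → A ≤ U
    chain-bound C chain =
      (⋃ , (⋃-isFilter , ⋃-omits-zero) , λ _ → inj₁) , λ A A∈C → lift λ w w∈A → in-member A A∈C w∈A
      where
      isF = proj₁ properF

      InChain : Carrier → Set (lsuc c)
      InChain w = Σ ProperAbove λ A → C A × proj₁ A w

      ⋃ : Subset
      ⋃ w = F w ⊎ Resize (InChain w)

      in-member : ∀ {w} A → C A → proj₁ A w → ⋃ w
      in-member {w} A A∈C w∈A = inj₂ (resize (InChain w) (A , A∈C , w∈A))

      decode : ∀ {w} → ⋃ w → F w ⊎ InChain w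
      decode (inj₁ w∈F) = inj₁ w∈F
      decode {w} (inj₂ r) = inj₂ (unresize (InChain w) r)

      isA : (A : ProperAbove) → IsImplicativeFilter (proj₁ A)
      isA A = proj₁ (proj₁ (proj₂ A))

      F⊆A : (A : ProperAbove) → F ⊆ proj₁ A
      F⊆A A = proj₂ (proj₂ A)

      ⋃-mp : ∀ x y → F x ⊎ InChain x → F (x ⇒ y) ⊎ InChain (x ⇒ y) → ⋃ y
      ⋃-mp x y (inj₁ x∈F) (inj₁ xy∈F) = inj₁ (mp isF x∈F xy∈F)
      ⋃-mp x y (inj₁ x∈F) (inj₂ (A , A∈C , xy∈A)) = in-member A A∈C (mp (isA A) (F⊆A A x x∈F) xy∈A)
      ⋃-mp x y (inj₂ (A , A∈C , x∈A)) (inj₁ xy∈F) = in-member A A∈C (mp (isA A) x∈A (F⊆A A _ xy∈F))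
      ⋃-mp x y (inj₂ (A , A∈C , x∈A)) (inj₂ (B , B∈C , xy∈B)) with chain A B A∈C B∈C
      ... | inj₁ (lift A⊆B) = in-member B B∈C (mp (isA B) (A⊆B x x∈A) xy∈B)
      ... | inj₂ (lift B⊆A) = in-member A A∈C (mp (isA A) x∈A (B⊆A _ xy∈B))

      ⋃-isFilter : IsImplicativeFilter ⋃
      ⋃-isFilter = inj₁ (proj₁ isF) , λ x y x∈⋃ xy∈⋃ → ⋃-mp x y (decode x∈⋃) (decode xy∈⋃)

      ⋃-omits-zero : ¬ ⋃ zero
      ⋃-omits-zero 0∈⋃ with decode 0∈⋃
      ... | inj₁ 0∈F = proj₂ properF 0∈F
      ... | inj₂ (A , _ , 0∈A) = proj₂ (proj₁ (proj₂ A)) 0∈A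

    maximal-extension : Σ Subset λ M → IsProperFilter M × F ⊆ M × IsMaximalProper M
    maximal-extension
      with zorn ProperAbove _≤_ (λ _ → lift λ _ w∈A → w∈A)
             (λ (lift A⊆B) (lift B⊆C) → lift λ w w∈A → B⊆C w (A⊆B w w∈A))
             chain-bound (F , properF , λ _ w∈F → w∈F)
    ... | (M , properM , F⊆M) , _ , maximal =
      M , properM , F⊆M , λ G properG M⊆G →
        lower (maximal (G , properG , λ w w∈F → M⊆G w (F⊆M w w∈F)) (lift M⊆G))

  -- A maximal proper filter M is irreducible: a decomposition M = G₁ ∩ G₂ into
  -- filters different from M forces 0 ∈ G₁ and 0 ∈ G₂, hence 0 ∈ M.
  maximalProper⇒irreducible : ∀ {M} → IsProperFilter M → IsMaximalProper M → IsIrreducible M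
  maximalProper⇒irreducible {M} (_ , 0∉M) maximal =
    (λ all → 0∉M (all zero)) ,
    λ (G₁ , G₂ , isG₁ , isG₂ , G₁≠M , G₂≠M , M⊆G₁∩G₂ , G₁∩G₂⊆M) →
      let M⊆G₁ = λ w w∈M → proj₁ (M⊆G₁∩G₂ w w∈M)
          M⊆G₂ = λ w w∈M → proj₂ (M⊆G₁∩G₂ w w∈M)
          0∈G₁ = by-contradiction λ 0∉G₁ → G₁≠M (maximal G₁ (isG₁ , 0∉G₁) M⊆G₁ , M⊆G₁)
          0∈G₂ = by-contradiction λ 0∉G₂ → G₂≠M (maximal G₂ (isG₂ , 0∉G₂) M⊆G₂ , M⊆G₂)
      in 0∉M (G₁∩G₂⊆M zero (0∈G₁ , 0∈G₂))

  extend-to-maximal : ∀ F → IsProperFilter F → Σ X λ Q → F ⊆ proj₁ Q × IsMaximal Q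
  extend-to-maximal F properF with maximal-extension F properF
  ... | M , properM , F⊆M , maximal =
    (M , proj₁ properM , maximalProper⇒irreducible properM maximal) , F⊆M ,
    λ Q M⊆Q → maximal (proj₁ Q) (filterOf Q , omits-zero Q) M⊆Q

  below-maximal : (P : X) → Σ X λ Q → P ⊑ Q × IsMaximal Q
  below-maximal P = extend-to-maximal (proj₁ P) (filterOf P , omits-zero P)

  -- A maximal point contains a or ¬a: if ¬a ∉ P then P+a is proper, lies in a
  -- maximal point Q ⊇ P, and maximality of P gives a ∈ Q ⊆ P.
  maximal-decides : (P : X) → IsMaximal P → ∀ a → proj₁ P a ⊎ proj₁ P (∼ a)
  maximal-decides P maxP a with dec (proj₁ P a)
  ... | yes a∈P = inj₁ a∈P
  ... | no a∉P = inj₂ (by-contradiction λ ∼a∉P →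
    let Q , P+a⊆Q , _ = extend-to-maximal (adjoin (proj₁ P) a) (adjoin-isFilter (filterOf P) a , ∼a∉P)
        P⊑Q = λ w w∈P → P+a⊆Q w (adjoin-⊇ (filterOf P) a w w∈P)
    in a∉P (maxP Q P⊑Q a (P+a⊆Q a (adjoin-∋ (filterOf P) a))))

module UpsetAlgebra {c : Level} (H : BoundedHilbertAlgebra c) where
  open Spectral H

  upsets-isBoundedImplicativeSemilattice : IsBoundedImplicativeSemilattice _≈ᵁ_ _⊆ᵁ_ _∩ᵁ_ _⇒ᵁ_ Xᵁ ∅ᵁ
  upsets-isBoundedImplicativeSemilattice = record
    { isBoundedMeetSemilattice = record
      { isMeetSemilattice = record
        { isPartialOrder = record
          { isPreorder = record
            { isEquivalence = record
              { refl = (λ _ h → h) , (λ _ h → h)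
              ; sym = λ (U⊆V , V⊆U) → V⊆U , U⊆V
              ; trans = λ (U⊆V , V⊆U) (V⊆W , W⊆V) →
                  (λ P h → V⊆W P (U⊆V P h)) , (λ P h → V⊆U P (W⊆V P h)) }
            ; reflexive = proj₁
            ; trans = λ U⊆V V⊆W P h → V⊆W P (U⊆V P h) }
          ; antisym = _,_ }
        ; infimum = λ U V → (λ _ → proj₁) , (λ _ → proj₂) , λ W W⊆U W⊆V P h → W⊆U P h , W⊆V P h }
      ; maximum = λ _ _ _ → tt }
    ; minimum = λ _ _ ()
    ; residuated = λ U V W →
        (λ U∩V⊆W P U∋P Q P⊑Q V∋Q → U∩V⊆W Q (proj₂ U P Q P⊑Q U∋P , V∋Q)) ,
        (λ U⊆V⇒W P (U∋P , V∋P) → U⊆V⇒W P U∋P P (λ _ h → h) V∋P) }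

  ⊆ᵁ⇒≤ : (U V : Upset) → U ⊆ᵁ V → HilbertOrder _≈ᵁ_ _⇒ᵁ_ Xᵁ ∅ᵁ U V
  ⊆ᵁ⇒≤ U V U⊆V = (λ _ _ → tt) , λ _ _ Q _ U∋Q → U⊆V Q U∋Q

  ⊑-refl : (P : X) → P ⊑ P
  ⊑-refl P _ h = h

  maximal-upward : (P Q : X) → IsMaximal P → P ⊑ Q → IsMaximal Q
  maximal-upward P Q maxP P⊑Q R Q⊑R w w∈R =
    P⊑Q w (maxP R (⊑-trans {P} {Q} {R} P⊑Q Q⊑R) w w∈R)

module UpsetsAtMaximalPoints {c : Level} (em : ExcludedMiddle (lsuc c)) (H : BoundedHilbertAlgebra c) where
  open Spectral H
  open Classical em
  open UpsetAlgebra H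

  -- Nothing lies strictly above a maximal point, so Peirce's law holds there.
  peirce-at-maximal : (Q : X) → IsMaximal Q → (V W : Upset) →
    proj₁ ((V ⇒ᵁ W) ⇒ᵁ V) Q → proj₁ V Q
  peirce-at-maximal Q maxQ V W k = by-contradiction⁺ λ V∌Q →
    V∌Q (k Q (⊑-refl Q) λ R Q⊑R V∋R → ⊥-elim (V∌Q (proj₂ V R Q (maxQ R Q⊑R) V∋R)))

module GammaDual {c : Level} (em : ExcludedMiddle (lsuc c)) (zorn : Zorn (lsuc c))
  (H : BoundedHilbertAlgebra c) (γ : BoundedHilbertAlgebra.Carrier H → BoundedHilbertAlgebra.Carrier H)
  (isγ : IsGammaOperator _≡_ (BoundedHilbertAlgebra._⇒_ H) (BoundedHilbertAlgebra.one H)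
           (BoundedHilbertAlgebra.zero H) γ) where
  open BoundedHilbertAlgebra H
  open IsGammaOperator isγ
  open Spectral H
  open Classical em
  open FilterCalculus H
  open IrreducibleFilters em H
  open MaximalFilters em zorn H
  open UpsetAlgebra H
  open UpsetsAtMaximalPoints em H

  -- At a non-maximal point P, γ a ∈ P implies a ∈ P: for a ∉ P separation
  -- gives z ∉ P with a ⇒ z, ¬z ⇒ z ∈ P, and γ5 would then put z in P.
  γ-reflects : (P : X) → ¬ IsMaximal P → preimage γ P ⊆ proj₁ P
  γ-reflects P notMax a γa∈P = by-contradiction λ a∉P →
    let z , z∉P , a⇒z∈P , ∼z⇒z∈P = separation P notMax a∉P
        isP = filterOf P
    in z∉P (mp isP ∼z⇒z∈P (mp isP a⇒z∈P (upward isP (γ5 a z) γa∈P)))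

  -- A maximal point contains γ0, since it contains γ0 or ¬γ0 ≤ γ0.
  maximal-∋-γzero : (P : X) → IsMaximal P → proj₁ P (γ zero)
  maximal-∋-γzero P maxP with maximal-decides P maxP (γ zero)
  ... | inj₁ γ0∈P = γ0∈P
  ... | inj₂ ∼γ0∈P = upward (filterOf P) (γ4 zero) ∼γ0∈P

  γπ-complete : ∀ U P → proj₁ U P ⊎ IsMaximal P → proj₁ (γπ γ U) P
  γπ-complete U P (inj₁ U∋P) Q γ⁻¹P⊆Q =
    proj₂ U P Q (λ w w∈P → γ⁻¹P⊆Q w (upward (filterOf P) (γ2 w) w∈P)) U∋P
  γπ-complete U P (inj₂ maxP) Q γ⁻¹P⊆Q =
    ⊥-elim (omits-zero Q (γ⁻¹P⊆Q zero (maximal-∋-γzero P maxP)))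

  γπ-sound : ∀ U P → proj₁ (γπ γ U) P → proj₁ U P ⊎ IsMaximal P
  γπ-sound U P P∈γπU with em {IsMaximal P}
  ... | yes maxP = inj₂ maxP
  ... | no notMax = inj₁ (P∈γπU P (γ-reflects P notMax))

  γπ-mono : ∀ U V → U ⊆ᵁ V → γπ γ U ⊆ᵁ γπ γ V
  γπ-mono U V U⊆V P P∈γπU Q γ⁻¹P⊆Q = U⊆V Q (P∈γπU Q γ⁻¹P⊆Q)

  γπ-⇒ : ∀ U V → γπ γ (U ⇒ᵁ V) ⊆ᵁ (γπ γ U ⇒ᵁ γπ γ V)
  γπ-⇒ U V P P∈γπU⇒V Q P⊑Q Q∈γπU = γπ-complete V Q (V-or-maximal (γπ-sound U Q Q∈γπU))
    where
    V-or-maximal : proj₁ U Q ⊎ IsMaximal Q → proj₁ V Q ⊎ IsMaximal Q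
    V-or-maximal (inj₂ maxQ) = inj₂ maxQ
    V-or-maximal (inj₁ U∋Q) with γπ-sound (U ⇒ᵁ V) P P∈γπU⇒V
    ... | inj₁ U⇒V∋P = inj₁ (U⇒V∋P Q P⊑Q U∋Q)
    ... | inj₂ maxP = inj₂ (maximal-upward P Q maxP P⊑Q)

  γπ-inflationary : ∀ U → U ⊆ᵁ γπ γ U
  γπ-inflationary U P U∋P = γπ-complete U P (inj₁ U∋P)

  γπ-peirce : ∀ U V → γπ γ U ⊆ᵁ (((V ⇒ᵁ U) ⇒ᵁ V) ⇒ᵁ V)
  γπ-peirce U V P P∈γπU Q P⊑Q k with γπ-sound U P P∈γπU
  ... | inj₁ U∋P = k Q (⊑-refl Q) λ R Q⊑R _ → proj₂ U P R (⊑-trans {P} {Q} {R} P⊑Q Q⊑R) U∋P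
  ... | inj₂ maxP = peirce-at-maximal Q (maximal-upward P Q maxP P⊑Q) V U k

  -- Every point lies below a maximal one, which belongs to γ^π(U).
  γπ-dense : ∀ U → (γπ γ U ⇒ᵁ ∅ᵁ) ⊆ᵁ γπ γ U
  γπ-dense U P ¬γπU∋P =
    let Q , P⊑Q , maxQ = below-maximal P
    in ⊥-elim (lower (¬γπU∋P Q P⊑Q (γπ-complete U Q (inj₂ maxQ))))

  γπ-γ5 : ∀ U V → γπ γ U ⊆ᵁ ((U ⇒ᵁ V) ⇒ᵁ (((V ⇒ᵁ ∅ᵁ) ⇒ᵁ V) ⇒ᵁ V))
  γπ-γ5 U V P P∈γπU Q P⊑Q U⇒V∋Q R Q⊑R k with γπ-sound U P P∈γπU
  ... | inj₁ U∋P = U⇒V∋Q R Q⊑R (proj₂ U P R (⊑-trans {P} {Q} {R} P⊑Q Q⊑R) U∋P)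
  ... | inj₂ maxP = peirce-at-maximal R (maximal-upward P R maxP (⊑-trans {P} {Q} {R} P⊑Q Q⊑R)) V ∅ᵁ k

  γπ-isGammaOperator : IsGammaOperator _≈ᵁ_ _⇒ᵁ_ Xᵁ ∅ᵁ (γπ γ)
  γπ-isGammaOperator = record
    { τ-cong = λ {U} {V} (U⊆V , V⊆U) → γπ-mono U V U⊆V , γπ-mono V U V⊆U
    ; γ1 = λ U V → ⊆ᵁ⇒≤ (γπ γ (U ⇒ᵁ V)) (γπ γ U ⇒ᵁ γπ γ V) (γπ-⇒ U V)
    ; γ2 = λ U → ⊆ᵁ⇒≤ U (γπ γ U) (γπ-inflationary U)
    ; γ3 = λ U V → ⊆ᵁ⇒≤ (γπ γ U) (((V ⇒ᵁ U) ⇒ᵁ V) ⇒ᵁ V) (γπ-peirce U V)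
    ; γ4 = λ U → ⊆ᵁ⇒≤ (γπ γ U ⇒ᵁ ∅ᵁ) (γπ γ U) (γπ-dense U)
    ; γ5 = λ U V → ⊆ᵁ⇒≤ (γπ γ U) ((U ⇒ᵁ V) ⇒ᵁ (((V ⇒ᵁ ∅ᵁ) ⇒ᵁ V) ⇒ᵁ V)) (γπ-γ5 U V)
    }

lemma4p5 : {c : Level} → ExcludedMiddle (lsuc c) → Zorn (lsuc c) →
    (H : BoundedHilbertAlgebra c) →
    (γ : BoundedHilbertAlgebra.Carrier H → BoundedHilbertAlgebra.Carrier H) →
    IsGammaOperator _≡_ (BoundedHilbertAlgebra._⇒_ H) (BoundedHilbertAlgebra.one H) (BoundedHilbertAlgebra.zero H) γ →
    let open Spectral H in
      IsBoundedImplicativeSemilattice _≈ᵁ_ _⊆ᵁ_ _∩ᵁ_ _⇒ᵁ_ Xᵁ ∅ᵁ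
      × IsGammaOperator _≈ᵁ_ _⇒ᵁ_ Xᵁ ∅ᵁ (γπ γ)
      × (∀ U P → (proj₁ (γπ γ U) P → proj₁ U P ⊎ IsMaximal P)
                × (proj₁ U P ⊎ IsMaximal P → proj₁ (γπ γ U) P))
lemma4p5 em zorn H γ isγ =
  upsets-isBoundedImplicativeSemilattice , γπ-isGammaOperator , λ U P → γπ-sound U P , γπ-complete U P
  where
  open UpsetAlgebra H
  open GammaDual em zorn H γ isγ
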